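{- For $i=1,2$, let $\mathcal{F}_i$ be a $D_i$-max-universal family of simple $2$-connected graphs such that each graph in $\mathcal{F}_i$ has a vertex of degree $3$. Then the zip product of $\mathcal{F}_1$ and $\mathcal{F}_2$ is a $(D_1\cup D_2)$-max-universal family.
   Context: Graphs are finite and loopless. For a finite set $D\subseteq\mathbb{N}$, a family $\mathcal{F}$ of graphs is $D$-universal if for every integer $m$ there is $G\in\mathcal{F}$ having, for every $d\in D$, at least $m$ vertices of degree $d$. $\mathcal{F}$ is $D$-max-universal if it is $D$-universal, only finitely many degrees not in $D$ appear in graphs of $\mathcal{F}$, and there is an integer $M$ such that any degree not in $D$ appears at most $M$ times in any graph of $\mathcal{F}$. Zip product of graphs: for $i=1,2$ let $G_i$ be a graph and $v_i\in V(G_i)$ a vertex of degree $3$ such that $G_i-v_i$ is connected and $v_i$ is incident only to simple edges; denote the neighbours of $v_i$ by $u^i_1,u^i_2,u^i_3$. The zip product of $G_1$ and $G_2$ according to $v_1,v_2$ (and this labelling of neighbours) is obtained from the disjoint union of $G_1-v_1$ and $G_2-v_2$ by adding the three edges $u^1_1u^2_1$, $u^1_2u^2_2$, $u^1_3u^2_3$. For families $\mathcal{F}_1,\mathcal{F}_2$ of simple $2$-connected graphs each having a vertex of degree $3$, the zip product of $\mathcal{F}_1$ and $\mathcal{F}_2$ is the family of all graphs $H$ such that there exist $G_1\in\mathcal{F}_1$, $G_2\in\mathcal{F}_2$ and degree-$3$ vertices $v_1\in V(G_1)$, $v_2\in V(G_2)$ with $H$ a zip product of $G_1$ and $G_2$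 according to $v_1,v_2$. -}

module Defs where

open import Data.Nat using (ℕ; zero; suc; _+_; _≤_)
open import Data.Bool using (Bool; true; false; _∧_; T)
open import Data.Fin using (Fin; splitAt; punchIn)
open import Data.Fin.Properties using (_≟_)
open import Data.List using (List; length; filterᵇ; allFin)
open import Data.Bool.ListAction using (any)
open import Data.Empty using (⊥)
open import Data.List.Membership.Propositional using (_∈_; _∉_)
open import Data.Sum using (_⊎_; inj₁; inj₂)
open import Data.Product using (Σ; ∃; ∃-syntax; _×_; _,_)
open import Relation.Binary.PropositionalEquality using (_≡_; refl)
open import Relation.Nullary.Decidable using (⌊_⌋)
open import Function.Bundles using (_↔_; Inverse)
open import Function.Definitions using (Injective)

record Graph (n : ℕ) : Set where
  field
    adj    : Fin n → Fin n → Bool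
    sym    : ∀ i j → adj i j ≡ adj j i
    irrefl : ∀ i → adj i i ≡ false
open Graph public

deg : ∀ {n} → Graph n → Fin n → ℕ
deg {n} G v = length (filterᵇ (adj G v) (allFin n))

countDeg : ∀ {n} → Graph n → ℕ → ℕ
countDeg {n} G d = length (filterᵇ (λ v → ⌊ deg G v Data.Nat.≟ d ⌋) (allFin n))

delete : ∀ {n} → Graph (suc n) → Fin (suc n) → Graph n
delete G v = record
  { adj    = λ i j → adj G (punchIn v i) (punchIn v j)
  ; sym    = λ i j → sym G (punchIn v i) (punchIn v j)
  ; irrefl = λ i → irrefl G (punchIn v i) }

data Walk {n} (G : Graph n) : Fin n → Fin n → Set where
  here : ∀ {u} → Walk G u u
  step : ∀ {u v w} → adj G u v ≡ true → Walk G v w → Walk G u w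

Connected : ∀ {n} → Graph n → Set
Connected {n} G = ∀ (u w : Fin n) → Walk G u w

TwoConnected : ∀ {n} → Graph n → Set
TwoConnected {zero} G = ⊥
TwoConnected {suc n} G = 3 ≤ suc n × Connected G × (∀ v → Connected (delete G v))

_≅_ : ∀ {n m} → Graph n → Graph m → Set
_≅_ {n} {m} G H = Σ (Fin n ↔ Fin m) λ f →
  ∀ i j → adj G i j ≡ adj H (Inverse.to f i) (Inverse.to f j)

Family : Set₁
Family = ∀ n → Graph n → Set

-- finite sets of naturals are lists
Universal : List ℕ → Family → Set
Universal D F = ∀ (m : ℕ) → ∃[ n ] Σ (Graph n) λ G → F n G × (∀ d → d ∈ D → m ≤ countDeg G d)

MaxUniversal : List ℕ → Family → Set
MaxUniversal D F =
  Universal D F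
  × (∃[ E ] ∀ n (G : Graph n) → F n G → ∀ v → deg G v ∉ D → deg G v ∈ E)
  × (∃[ M ] ∀ n (G : Graph n) → F n G → ∀ d → d ∉ D → countDeg G d ≤ M)

-- A zip vertex: a degree-3 vertex v with G - v connected, together with a
-- labelling a : Fin 3 → V(G - v) of its three neighbours (as vertices of G - v).
-- (All graphs are simple, so v is incident only to simple edges.)
record ZipVertex {n} (G : Graph (suc n)) (v : Fin (suc n)) : Set where
  field
    deg3   : deg G v ≡ 3
    conn   : Connected (delete G v)
    nb     : Fin 3 → Fin n
    nb-inj : Injective _≡_ _≡_ nb
    nb-adj : ∀ k → adj G v (punchIn v (nb k)) ≡ true
    nb-all : ∀ x → adj G v (punchIn v x) ≡ true → ∃[ k ] nb k ≡ x
open ZipVertex public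

cross : ∀ {n₁ n₂} → (Fin 3 → Fin n₁) → (Fin 3 → Fin n₂) → Fin n₁ → Fin n₂ → Bool
cross a b i j = any (λ k → ⌊ a k ≟ i ⌋ ∧ ⌊ b k ≟ j ⌋) (allFin 3)

module _ {n₁ n₂} (G₁ : Graph n₁) (G₂ : Graph n₂) (c : Fin n₁ → Fin n₂ → Bool) where
  adj⊎ : Fin n₁ ⊎ Fin n₂ → Fin n₁ ⊎ Fin n₂ → Bool
  adj⊎ (inj₁ i) (inj₁ j) = adj G₁ i j
  adj⊎ (inj₂ i) (inj₂ j) = adj G₂ i j
  adj⊎ (inj₁ i) (inj₂ j) = c i j
  adj⊎ (inj₂ j) (inj₁ i) = c i j

  sym⊎ : ∀ x y → adj⊎ x y ≡ adj⊎ y x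
  sym⊎ (inj₁ i) (inj₁ j) = sym G₁ i j
  sym⊎ (inj₂ i) (inj₂ j) = sym G₂ i j
  sym⊎ (inj₁ i) (inj₂ j) = refl
  sym⊎ (inj₂ j) (inj₁ i) = refl

  irrefl⊎ : ∀ x → adj⊎ x x ≡ false
  irrefl⊎ (inj₁ i) = irrefl G₁ i
  irrefl⊎ (inj₂ i) = irrefl G₂ i

  joinGraph : Graph (n₁ + n₂)
  joinGraph = record
    { adj    = λ i j → adj⊎ (splitAt n₁ i) (splitAt n₁ j)
    ; sym    = λ i j → sym⊎ (splitAt n₁ i) (splitAt n₁ j)
    ; irrefl = λ i → irrefl⊎ (splitAt n₁ i) }

zipGraph : ∀ {n₁ n₂} (G₁ : Graph (suc n₁)) (v₁ : Fin (suc n₁)) (z₁ : ZipVertex G₁ v₁)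
             (G₂ : Graph (suc n₂)) (v₂ : Fin (suc n₂)) (z₂ : ZipVertex G₂ v₂) → Graph (n₁ + n₂)
zipGraph G₁ v₁ z₁ G₂ v₂ z₂ = joinGraph (delete G₁ v₁) (delete G₂ v₂) (cross (nb z₁) (nb z₂))

ZipFamily : Family → Family → Family
ZipFamily F₁ F₂ m H =
  ∃[ n₁ ] ∃[ n₂ ] Σ (Graph (suc n₁)) λ G₁ → Σ (Graph (suc n₂)) λ G₂ →
    F₁ (suc n₁) G₁ × F₂ (suc n₂) G₂ ×
    Σ (Fin (suc n₁)) λ v₁ → Σ (Fin (suc n₂)) λ v₂ →
    Σ (ZipVertex G₁ v₁) λ z₁ → Σ (ZipVertex G₂ v₂) λ z₂ →
    H ≅ zipGraph G₁ v₁ z₁ G₂ v₂ z₂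

-- Every vertex of G₁ - v₁ or G₂ - v₂ keeps its degree in a zip product: the edge it
-- loses to vᵢ is replaced by exactly one cross edge, because the neighbour labellings
-- are injective and cover exactly the neighbours of vᵢ.  So the zip product of G₁ and
-- G₂ has, for every d, the vertices of degree d of G₁ and of G₂ except possibly v₁ and
-- v₂.  Gluing members of F₁ and F₂ with at least m + 1 vertices of each degree of D₁
-- resp. D₂ gives universality; a degree outside D₁ ∪ D₂ occurring in the product
-- occurs outside Dᵢ in some Gᵢ, hence lies in E₁ ∪ E₂ and occurs at most M₁ + M₂ times.

module Submission where

open import Defs
open import Data.Nat using (ℕ; suc)
open import Data.List using (List; _++_)
open import Data.Product using (_×_; ∃-syntax)
open import Relation.Binary.PropositionalEquality using (_≡_)

open import Data.Nat using (_+_; _≤_; z≤n; s≤s; s≤s⁻¹) renaming (_≟_ to _≟ℕ_)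
open import Data.Nat.Properties using (+-0-commutativeMonoid; +-assoc; +-comm; ≤-refl; ≤-trans; m≤m+n; m≤n+m; +-mono-≤)
open import Algebra.Properties.CommutativeMonoid.Sum +-0-commutativeMonoid
  using (sum; sum-remove; sum-permute; sum-cong-≗; sum-replicate-zero)
open import Data.Bool using (Bool; true; false; _∧_)
open import Data.Bool.Properties using (T-≡; T-∧; ∧-comm; ¬-not)
open import Data.Bool.ListAction using (or)
open import Data.Fin using (Fin; splitAt; punchIn) renaming (zero to fzero; suc to fsuc)
open import Data.Fin.Properties using (_≟_; punchInᵢ≢i)
open import Data.List using (_∷_; length; filterᵇ; allFin; tabulate; lookup)
open import Data.List.Properties using (map-cong)
open import Data.List.Membership.Propositional using (_∈_; _∉_)
open import Data.List.Membership.Propositional.Properties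
  using (∈-++⁺ˡ; ∈-++⁺ʳ; ∈-++⁻; ∈-filter⁺; ∈-filter⁻; ∈-allFin; ∈-lookup)
import Data.List.Relation.Unary.All as All
open import Data.List.Relation.Unary.AllPairs using (_∷_)
open import Data.List.Relation.Unary.Any using (index)
open import Data.List.Relation.Unary.Any.Properties using (any⁺; any⁻; tabulate⁺; tabulate⁻; lookup-index)
open import Data.List.Relation.Unary.Unique.Propositional using (Unique)
open import Data.List.Relation.Unary.Unique.Propositional.Properties using (allFin⁺; filter⁺)
open import Data.Product using (Σ; _,_; proj₁; proj₂)
open import Data.Sum using (_⊎_; inj₁; inj₂; [_,_]′)
import Data.Sum as Sum
open import Function using (_∘_; id; Equivalence)
open import Function.Bundles using (Inverse)
open import Function.Definitions using (Injective)
open import Function.Properties.Inverse using (↔-refl)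
open import Relation.Binary.PropositionalEquality
  using (refl; trans; cong; cong₂; subst; _≢_; module ≡-Reasoning) renaming (sym to ≡-sym)
open import Relation.Nullary.Decidable using (⌊_⌋; T?; toWitness; fromWitness)
open import Relation.Nullary.Negation using (contradiction)

indicator : Bool → ℕ
indicator true  = 1
indicator false = 0

length-filterᵇ-tabulate : ∀ {A : Set} {n} (f : Fin n → A) (p : A → Bool) →
  length (filterᵇ p (tabulate f)) ≡ sum (indicator ∘ p ∘ f)
length-filterᵇ-tabulate {n = 0}     f p = refl
length-filterᵇ-tabulate {n = suc n} f p with p (f fzero)
... | true  = cong suc (length-filterᵇ-tabulate (f ∘ fsuc) p)
... | false = length-filterᵇ-tabulate (f ∘ fsuc) p

deg≡sum : ∀ {n} (G : Graph n) v → deg G v ≡ sum (indicator ∘ adj G v)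
deg≡sum G v = length-filterᵇ-tabulate id (adj G v)

countDeg≡sum : ∀ {n} (G : Graph n) d → countDeg G d ≡ sum (λ v → indicator ⌊ deg G v ≟ℕ d ⌋)
countDeg≡sum G d = length-filterᵇ-tabulate id (λ v → ⌊ deg G v ≟ℕ d ⌋)

sum-splitAt : ∀ n₁ {n₂} (h : Fin n₁ ⊎ Fin n₂ → ℕ) →
  sum (h ∘ splitAt n₁) ≡ sum (h ∘ inj₁) + sum (h ∘ inj₂)
sum-splitAt 0         h = refl
sum-splitAt (suc n₁)  h = trans (cong (h (inj₁ fzero) +_) (sum-splitAt n₁ (h ∘ Sum.map₁ fsuc)))
                                (≡-sym (+-assoc (h (inj₁ fzero)) _ _))

sum-indicator-false : ∀ {n} (q : Fin n → Bool) → (∀ j → q j ≢ true) → sum (indicator ∘ q) ≡ 0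
sum-indicator-false {n} q q≢true =
  trans (sum-cong-≗ (cong indicator ∘ ¬-not ∘ q≢true)) (sum-replicate-zero n)

sum-indicator-unique : ∀ {n} (q : Fin n → Bool) t → q t ≡ true → (∀ j → q j ≡ true → j ≡ t) →
  sum (indicator ∘ q) ≡ 1
sum-indicator-unique {suc _} q t qt≡true unique = begin
  sum (indicator ∘ q)                               ≡⟨ sum-remove {i = t} (indicator ∘ q) ⟩
  indicator (q t) + sum (indicator ∘ q ∘ punchIn t) ≡⟨ cong₂ _+_ (cong indicator qt≡true) rest≡0 ⟩
  1                                                 ∎
  where
  open ≡-Reasoning
  rest≡0 : sum (indicator ∘ q ∘ punchIn t) ≡ 0
  rest≡0 = sum-indicator-false (q ∘ punchIn t) (λ j → punchInᵢ≢i t j ∘ unique (punchIn t j))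

lookup-injective : ∀ {A : Set} {xs : List A} → Unique xs → Injective _≡_ _≡_ (lookup xs)
lookup-injective {xs = _ ∷ _} (_ ∷ _)       {fzero}  {fzero}  _  = refl
lookup-injective {xs = _ ∷ _} (x∉xs ∷ _)    {fzero}  {fsuc j} eq = contradiction eq (All.lookup x∉xs (∈-lookup j))
lookup-injective {xs = _ ∷ _} (x∉xs ∷ _)    {fsuc i} {fzero}  eq = contradiction (≡-sym eq) (All.lookup x∉xs (∈-lookup i))
lookup-injective {xs = _ ∷ _} (_ ∷ unique)  {fsuc i} {fsuc j} eq = cong fsuc (lookup-injective unique eq)

record Enumeration {n} (p : Fin n → Bool) (k : ℕ) : Set where
  field
    elem           : Fin k → Fin n
    elem-injective : Injective _≡_ _≡_ elem
    elem-sound     : ∀ t → p (elem t) ≡ true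
    elem-complete  : ∀ x → p x ≡ true → ∃[ t ] elem t ≡ x

enumeration : ∀ {n} (p : Fin n → Bool) → Enumeration p (sum (indicator ∘ p))
enumeration {n} p = subst (Enumeration p) (length-filterᵇ-tabulate id p) record
  { elem           = lookup xs
  ; elem-injective = lookup-injective (filter⁺ (T? ∘ p) (allFin⁺ n))
  ; elem-sound     = λ t → Equivalence.to T-≡ (proj₂ (∈-filter⁻ (T? ∘ p) {xs = allFin n} (∈-lookup t)))
  ; elem-complete  = λ x px → let x∈xs = ∈-filter⁺ (T? ∘ p) (∈-allFin x) (Equivalence.from T-≡ px)
                              in index x∈xs , ≡-sym (lookup-index x∈xs)
  }
  where xs = filterᵇ p (allFin n)

module _ {n₁ n₂} (a : Fin 3 → Fin n₁) (b : Fin 3 → Fin n₂) where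

  private
    labelled : Fin n₁ → Fin n₂ → Fin 3 → Bool
    labelled i j k = ⌊ a k ≟ i ⌋ ∧ ⌊ b k ≟ j ⌋

  cross-true⁻ : ∀ {i j} → cross a b i j ≡ true → ∃[ k ] a k ≡ i × b k ≡ j
  cross-true⁻ {i} {j} c with tabulate⁻ {f = id} (any⁻ (labelled i j) (allFin 3) (Equivalence.from T-≡ c))
  ... | k , match with Equivalence.to (T-∧ {⌊ a k ≟ i ⌋}) match
  ...   | ak≟i , bk≟j = k , toWitness ak≟i , toWitness bk≟j

  cross-true⁺ : ∀ {i j} k → a k ≡ i → b k ≡ j → cross a b i j ≡ true
  cross-true⁺ {i} {j} k ak≡i bk≡j = Equivalence.to T-≡ (any⁺ (labelled i j) (tabulate⁺ {f = id} k
    (Equivalence.from T-∧ (fromWitness {a? = a k ≟ i} ak≡i , fromWitness {a? = b k ≟ j} bk≡j))))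

  cross-comm : ∀ i j → cross a b i j ≡ cross b a j i
  cross-comm i j = cong or (map-cong (λ k → ∧-comm ⌊ a k ≟ i ⌋ ⌊ b k ≟ j ⌋) (allFin 3))

  sum-cross-hit : Injective _≡_ _≡_ a → ∀ {i} k → a k ≡ i → sum (indicator ∘ cross a b i) ≡ 1
  sum-cross-hit a-injective k ak≡i = sum-indicator-unique (cross a b _) (b k) (cross-true⁺ k ak≡i refl) unique
    where
    unique : ∀ j → cross a b _ j ≡ true → j ≡ b k
    unique j c with cross-true⁻ c
    ... | k′ , ak′≡i , bk′≡j = trans (≡-sym bk′≡j) (cong b (a-injective (trans ak′≡i (≡-sym ak≡i))))

  sum-cross-miss : ∀ {i} → (∀ k → a k ≢ i) → sum (indicator ∘ cross a b i) ≡ 0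
  sum-cross-miss a≢i = sum-indicator-false (cross a b _) (λ j c → a≢i _ (proj₁ (proj₂ (cross-true⁻ c))))

deg-delete : ∀ {n} (G : Graph (suc n)) v i →
  deg G (punchIn v i) ≡ indicator (adj G v (punchIn v i)) + deg (delete G v) i
deg-delete G v i = begin
  deg G u                                                       ≡⟨ deg≡sum G u ⟩
  sum (indicator ∘ adj G u)                                     ≡⟨ sum-remove {i = v} (indicator ∘ adj G u) ⟩
  indicator (adj G u v) + sum (indicator ∘ adj G u ∘ punchIn v) ≡⟨ cong₂ _+_ (cong indicator (sym G u v))
                                                                             (≡-sym (deg≡sum (delete G v) i)) ⟩
  indicator (adj G v u) + deg (delete G v) i                    ∎
  where
  open ≡-Reasoning
  u = punchIn v i

module _ {n₁ n₂} (G₁ : Graph n₁) (G₂ : Graph n₂) (c : Fin n₁ → Fin n₂ → Bool) where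

  degJoin : Fin n₁ ⊎ Fin n₂ → ℕ
  degJoin = [ (λ i → deg G₁ i + sum (indicator ∘ c i)) , (λ j → sum (λ i → indicator (c i j)) + deg G₂ j) ]′

  deg-joinGraph : ∀ x → deg (joinGraph G₁ G₂ c) x ≡ degJoin (splitAt n₁ x)
  deg-joinGraph x = trans (deg≡sum (joinGraph G₁ G₂ c) x) (row (splitAt n₁ x))
    where
    row : ∀ s → sum (indicator ∘ adj⊎ G₁ G₂ c s ∘ splitAt n₁) ≡ degJoin s
    row (inj₁ i) = trans (sum-splitAt n₁ (indicator ∘ adj⊎ G₁ G₂ c (inj₁ i)))
                         (cong (_+ sum (indicator ∘ c i)) (≡-sym (deg≡sum G₁ i)))
    row (inj₂ j) = trans (sum-splitAt n₁ (indicator ∘ adj⊎ G₁ G₂ c (inj₂ j)))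
                         (cong (sum (λ i → indicator (c i j)) +_) (≡-sym (deg≡sum G₂ j)))

sum-cross-nb : ∀ {n m} {G : Graph (suc n)} {v} (z : ZipVertex G v) (b : Fin 3 → Fin m) i →
  sum (indicator ∘ cross (nb z) b i) ≡ indicator (adj G v (punchIn v i))
sum-cross-nb {G = G} {v} z b i with adj G v (punchIn v i) in v~i
... | true  = sum-cross-hit (nb z) b (nb-inj z) _ (proj₂ (nb-all z i v~i))
... | false = sum-cross-miss (nb z) b λ k nbk≡i →
  contradiction (trans (≡-sym (nb-adj z k)) (trans (cong (adj G v ∘ punchIn v) nbk≡i) v~i)) λ ()

countDegExcept : ∀ {n} → Graph (suc n) → Fin (suc n) → ℕ → ℕ
countDegExcept G v d = sum (λ i → indicator ⌊ deg G (punchIn v i) ≟ℕ d ⌋)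

countDeg-remove : ∀ {n} (G : Graph (suc n)) v d →
  countDeg G d ≡ indicator ⌊ deg G v ≟ℕ d ⌋ + countDegExcept G v d
countDeg-remove G v d = trans (countDeg≡sum G d) (sum-remove {i = v} (λ u → indicator ⌊ deg G u ≟ℕ d ⌋))

indicator≤1 : ∀ b → indicator b ≤ 1
indicator≤1 true  = ≤-refl
indicator≤1 false = z≤n

countDegExcept≤countDeg : ∀ {n} (G : Graph (suc n)) v d → countDegExcept G v d ≤ countDeg G d
countDegExcept≤countDeg G v d =
  subst (countDegExcept G v d ≤_) (≡-sym (countDeg-remove G v d)) (m≤n+m _ _)

countDeg≤1+countDegExcept : ∀ {n} (G : Graph (suc n)) v d → countDeg G d ≤ suc (countDegExcept G v d)
countDeg≤1+countDegExcept G v d =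
  subst (_≤ suc (countDegExcept G v d)) (≡-sym (countDeg-remove G v d)) (+-mono-≤ (indicator≤1 _) ≤-refl)

module _ {n₁ n₂} {G₁ : Graph (suc n₁)} {v₁} (z₁ : ZipVertex G₁ v₁)
                 {G₂ : Graph (suc n₂)} {v₂} (z₂ : ZipVertex G₂ v₂) where

  private
    Z : Graph (n₁ + n₂)
    Z = zipGraph G₁ v₁ z₁ G₂ v₂ z₂

  degSource : Fin n₁ ⊎ Fin n₂ → ℕ
  degSource = [ deg G₁ ∘ punchIn v₁ , deg G₂ ∘ punchIn v₂ ]′

  deg-zipGraph : ∀ x → deg Z x ≡ degSource (splitAt n₁ x)
  deg-zipGraph x = trans (deg-joinGraph (delete G₁ v₁) (delete G₂ v₂) (cross (nb z₁) (nb z₂)) x)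
                         (side (splitAt n₁ x))
    where
    side : ∀ s → degJoin (delete G₁ v₁) (delete G₂ v₂) (cross (nb z₁) (nb z₂)) s ≡ degSource s
    side (inj₁ i) = trans (cong (deg (delete G₁ v₁) i +_) (sum-cross-nb z₁ (nb z₂) i))
                          (trans (+-comm (deg (delete G₁ v₁) i) _) (≡-sym (deg-delete G₁ v₁ i)))
    side (inj₂ j) = trans (cong (_+ deg (delete G₂ v₂) j)
                                (trans (sum-cong-≗ (λ i → cong indicator (cross-comm (nb z₁) (nb z₂) i j)))
                                       (sum-cross-nb z₂ (nb z₁) j)))
                          (≡-sym (deg-delete G₂ v₂ j))

  countDeg-zipGraph : ∀ d → countDeg Z d ≡ countDegExcept G₁ v₁ d + countDegExcept G₂ v₂ d
  countDeg-zipGraph d = begin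
    countDeg Z d                                               ≡⟨ countDeg≡sum Z d ⟩
    sum (λ x → indicator ⌊ deg Z x ≟ℕ d ⌋)                     ≡⟨ sum-cong-≗ (cong (λ e → indicator ⌊ e ≟ℕ d ⌋) ∘ deg-zipGraph) ⟩
    sum (h ∘ splitAt n₁)                                       ≡⟨ sum-splitAt n₁ h ⟩
    countDegExcept G₁ v₁ d + countDegExcept G₂ v₂ d            ∎
    where
    open ≡-Reasoning
    h : Fin n₁ ⊎ Fin n₂ → ℕ
    h s = indicator ⌊ degSource s ≟ℕ d ⌋

  countDeg-zipGraph-≤ : ∀ d → countDeg Z d ≤ countDeg G₁ d + countDeg G₂ d
  countDeg-zipGraph-≤ d = subst (_≤ countDeg G₁ d + countDeg G₂ d) (≡-sym (countDeg-zipGraph d))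
    (+-mono-≤ (countDegExcept≤countDeg G₁ v₁ d) (countDegExcept≤countDeg G₂ v₂ d))

  countDeg≤1+countDeg-zipGraph₁ : ∀ d → countDeg G₁ d ≤ suc (countDeg Z d)
  countDeg≤1+countDeg-zipGraph₁ d = ≤-trans (countDeg≤1+countDegExcept G₁ v₁ d)
    (s≤s (subst (countDegExcept G₁ v₁ d ≤_) (≡-sym (countDeg-zipGraph d)) (m≤m+n _ _)))

  countDeg≤1+countDeg-zipGraph₂ : ∀ d → countDeg G₂ d ≤ suc (countDeg Z d)
  countDeg≤1+countDeg-zipGraph₂ d = ≤-trans (countDeg≤1+countDegExcept G₂ v₂ d)
    (s≤s (subst (countDegExcept G₂ v₂ d ≤_) (≡-sym (countDeg-zipGraph d)) (m≤n+m _ _)))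

deg-≅ : ∀ {n m} (H : Graph n) (G : Graph m) (iso : H ≅ G) i → deg H i ≡ deg G (Inverse.to (proj₁ iso) i)
deg-≅ H G (f , adj≡) i = begin
  deg H i                                   ≡⟨ deg≡sum H i ⟩
  sum (indicator ∘ adj H i)                 ≡⟨ sum-cong-≗ (cong indicator ∘ adj≡ i) ⟩
  sum (indicator ∘ adj G fi ∘ Inverse.to f) ≡⟨ sum-permute (indicator ∘ adj G fi) f ⟨
  sum (indicator ∘ adj G fi)                ≡⟨ deg≡sum G fi ⟨
  deg G fi                                  ∎
  where
  open ≡-Reasoning
  fi = Inverse.to f i

countDeg-≅ : ∀ {n m} (H : Graph n) (G : Graph m) → H ≅ G → ∀ d → countDeg H d ≡ countDeg G d
countDeg-≅ H G (f , adj≡) d = begin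
  countDeg H d                                         ≡⟨ countDeg≡sum H d ⟩
  sum (λ i → indicator ⌊ deg H i ≟ℕ d ⌋)               ≡⟨ sum-cong-≗ (cong (λ e → indicator ⌊ e ≟ℕ d ⌋) ∘ deg-≅ H G (f , adj≡)) ⟩
  sum (λ i → indicator ⌊ deg G (Inverse.to f i) ≟ℕ d ⌋) ≡⟨ sum-permute (λ u → indicator ⌊ deg G u ≟ℕ d ⌋) f ⟨
  sum (λ u → indicator ⌊ deg G u ≟ℕ d ⌋)               ≡⟨ countDeg≡sum G d ⟨
  countDeg G d                                         ∎
  where open ≡-Reasoning

zipVertex : ∀ {n} {G : Graph (suc n)} {v} → TwoConnected G → deg G v ≡ 3 → ZipVertex G v
zipVertex {G = G} {v} (_ , _ , G-v-connected) degv≡3 = record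
  { deg3   = degv≡3
  ; conn   = G-v-connected v
  ; nb     = elem
  ; nb-inj = elem-injective
  ; nb-adj = elem-sound
  ; nb-all = elem-complete
  }
  where
  neighbours≡3 : sum (indicator ∘ adj G v ∘ punchIn v) ≡ 3
  neighbours≡3 = begin
    sum (indicator ∘ adj G v ∘ punchIn v)                         ≡⟨ cong (_+ sum (indicator ∘ adj G v ∘ punchIn v)) (cong indicator (irrefl G v)) ⟨
    indicator (adj G v v) + sum (indicator ∘ adj G v ∘ punchIn v) ≡⟨ sum-remove {i = v} (indicator ∘ adj G v) ⟨
    sum (indicator ∘ adj G v)                                     ≡⟨ deg≡sum G v ⟨
    deg G v                                                       ≡⟨ degv≡3 ⟩
    3                                                             ∎
    where open ≡-Reasoning
  open Enumeration (subst (Enumeration (adj G v ∘ punchIn v)) neighbours≡3 (enumeration (adj G v ∘ punchIn v)))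

HasZipVertex : Family → Set
HasZipVertex F = ∀ n (G : Graph n) → F n G → TwoConnected G × ∃[ v ] deg G v ≡ 3

module _ (F₁ F₂ : Family) (zip₁ : HasZipVertex F₁) (zip₂ : HasZipVertex F₂) where

  zipOf-members : ∀ {n₁ n₂} {G₁ : Graph n₁} {G₂ : Graph n₂} → F₁ n₁ G₁ → F₂ n₂ G₂ →
    ∃[ n ] Σ (Graph n) λ H → ZipFamily F₁ F₂ n H
      × (∀ d → countDeg G₁ d ≤ suc (countDeg H d)) × (∀ d → countDeg G₂ d ≤ suc (countDeg H d))
  zipOf-members {n₁} {n₂} {G₁} {G₂} G₁∈F₁ G₂∈F₂ with zip₁ n₁ G₁ G₁∈F₁ | zip₂ n₂ G₂ G₂∈F₂
  zipOf-members {0}      {_}                          _     _     | () , _          | _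
  zipOf-members {suc _}  {0}                          _     _     | _               | () , _
  zipOf-members {suc n₁} {suc n₂} {G₁} {G₂} G₁∈F₁ G₂∈F₂ | 2c₁ , v₁ , deg₁ | 2c₂ , v₂ , deg₂ =
    n₁ + n₂ , zipGraph G₁ v₁ z₁ G₂ v₂ z₂ ,
    (n₁ , n₂ , G₁ , G₂ , G₁∈F₁ , G₂∈F₂ , v₁ , v₂ , z₁ , z₂ , ↔-refl , λ _ _ → refl) ,
    countDeg≤1+countDeg-zipGraph₁ z₁ z₂ , countDeg≤1+countDeg-zipGraph₂ z₁ z₂
    where
    z₁ = zipVertex 2c₁ deg₁
    z₂ = zipVertex 2c₂ deg₂

  zipFamily-universal : ∀ {D₁ D₂} → Universal D₁ F₁ → Universal D₂ F₂ → Universal (D₁ ++ D₂) (ZipFamily F₁ F₂)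
  zipFamily-universal {D₁} U₁ U₂ m with U₁ (suc m) | U₂ (suc m)
  ... | _ , _ , G₁∈F₁ , many₁ | _ , _ , G₂∈F₂ , many₂ with zipOf-members G₁∈F₁ G₂∈F₂
  ...   | n , H , H∈F , lost₁ , lost₂ = n , H , H∈F , many
    where
    many : ∀ d → d ∈ D₁ ++ _ → m ≤ countDeg H d
    many d d∈D with ∈-++⁻ D₁ d∈D
    ... | inj₁ d∈D₁ = s≤s⁻¹ (≤-trans (many₁ d d∈D₁) (lost₁ d))
    ... | inj₂ d∈D₂ = s≤s⁻¹ (≤-trans (many₂ d d∈D₂) (lost₂ d))

zipFamily-otherDegrees : ∀ {D₁ D₂ E₁ E₂} (F₁ F₂ : Family) →
  (∀ n (G : Graph n) → F₁ n G → ∀ v → deg G v ∉ D₁ → deg G v ∈ E₁) →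
  (∀ n (G : Graph n) → F₂ n G → ∀ v → deg G v ∉ D₂ → deg G v ∈ E₂) →
  ∀ n (H : Graph n) → ZipFamily F₁ F₂ n H → ∀ x → deg H x ∉ D₁ ++ D₂ → deg H x ∈ E₁ ++ E₂
zipFamily-otherDegrees {D₁} {D₂} {E₁} {E₂} F₁ F₂ other₁ other₂ _ H
  (n₁ , _ , G₁ , G₂ , G₁∈F₁ , G₂∈F₂ , v₁ , v₂ , z₁ , z₂ , iso) x ∉D =
  subst (_∈ E₁ ++ E₂) (≡-sym degx≡) (side (splitAt n₁ y) (∉D ∘ subst (_∈ D₁ ++ D₂) (≡-sym degx≡)))
  where
  y = Inverse.to (proj₁ iso) x
  degx≡ : deg H x ≡ degSource z₁ z₂ (splitAt n₁ y)
  degx≡ = trans (deg-≅ H (zipGraph G₁ v₁ z₁ G₂ v₂ z₂) iso x) (deg-zipGraph z₁ z₂ y)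
  side : ∀ s → degSource z₁ z₂ s ∉ D₁ ++ D₂ → degSource z₁ z₂ s ∈ E₁ ++ E₂
  side (inj₁ i) ∉D = ∈-++⁺ˡ (other₁ _ G₁ G₁∈F₁ (punchIn v₁ i) (∉D ∘ ∈-++⁺ˡ))
  side (inj₂ j) ∉D = ∈-++⁺ʳ E₁ (other₂ _ G₂ G₂∈F₂ (punchIn v₂ j) (∉D ∘ ∈-++⁺ʳ D₁))

zipFamily-otherDegreeCounts : ∀ {D₁ D₂ M₁ M₂} (F₁ F₂ : Family) →
  (∀ n (G : Graph n) → F₁ n G → ∀ d → d ∉ D₁ → countDeg G d ≤ M₁) →
  (∀ n (G : Graph n) → F₂ n G → ∀ d → d ∉ D₂ → countDeg G d ≤ M₂) →
  ∀ n (H : Graph n) → ZipFamily F₁ F₂ n H → ∀ d → d ∉ D₁ ++ D₂ → countDeg H d ≤ M₁ + M₂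
zipFamily-otherDegreeCounts {D₁} F₁ F₂ few₁ few₂ _ H
  (_ , _ , G₁ , G₂ , G₁∈F₁ , G₂∈F₂ , v₁ , v₂ , z₁ , z₂ , iso) d ∉D =
  subst (_≤ _) (≡-sym (countDeg-≅ H (zipGraph G₁ v₁ z₁ G₂ v₂ z₂) iso d))
    (≤-trans (countDeg-zipGraph-≤ z₁ z₂ d)
             (+-mono-≤ (few₁ _ G₁ G₁∈F₁ d (∉D ∘ ∈-++⁺ˡ)) (few₂ _ G₂ G₂∈F₂ d (∉D ∘ ∈-++⁺ʳ D₁))))

lemma4p2 : (D₁ D₂ : List ℕ) (F₁ F₂ : Family) →
    MaxUniversal D₁ F₁ → MaxUniversal D₂ F₂ →
    (∀ n (G : Graph n) → F₁ n G → TwoConnected G × ∃[ v ] deg G v ≡ 3) →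
    (∀ n (G : Graph n) → F₂ n G → TwoConnected G × ∃[ v ] deg G v ≡ 3) →
    MaxUniversal (D₁ ++ D₂) (ZipFamily F₁ F₂)
lemma4p2 D₁ D₂ F₁ F₂ (U₁ , (E₁ , other₁) , (M₁ , few₁)) (U₂ , (E₂ , other₂) , (M₂ , few₂)) zip₁ zip₂ =
  zipFamily-universal F₁ F₂ zip₁ zip₂ U₁ U₂ ,
  (E₁ ++ E₂ , zipFamily-otherDegrees F₁ F₂ other₁ other₂) ,
  (M₁ + M₂ , zipFamily-otherDegreeCounts F₁ F₂ few₁ few₂)
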